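{- Suppose there is a binary LCD $[n,k,d]$ code $C$ with $d(C^\perp) \ge 2$. If $n-k \ge 2^k$, then there is a binary LCD $[n-2,k]$ code $D$ with $d(D^\perp) \ge 2$.
   Context: All codes are binary linear codes; an $[n,k]$ code is a $k$-dimensional subspace of $\mathbb{F}_2^n$, an $[n,k,d]$ code additionally has minimum nonzero Hamming weight $d$; $d(D)$ denotes the minimum nonzero weight of a code $D$. A code $C$ is LCD if $C \cap C^\perp = \{\mathbf{0}_n\}$, where $C^\perp$ is the dual with respect to the standard inner product. -}

module Defs where

open import Data.Bool using (Bool; true; false; _xor_; _∧_)
open import Data.Nat using (ℕ; zero; suc; _+_; _≤_)
open import Data.Vec using (Vec; []; _∷_; zipWith; replicate; foldr)
open import Data.Product using (Σ; ∃; _×_; _,_)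
open import Relation.Binary.PropositionalEquality using (_≡_; _≢_)

Word : ℕ → Set
Word n = Vec Bool n

0w : ∀ {n} → Word n
0w = replicate _ false

_⊕_ : ∀ {n} → Word n → Word n → Word n
_⊕_ = zipWith _xor_

_·_ : ∀ {n} → Bool → Word n → Word n
b · x = Data.Vec.map (b ∧_) x

dot : ∀ {n} → Word n → Word n → Bool
dot x y = foldr _ _xor_ false (zipWith _∧_ x y)

wt : ∀ {n} → Word n → ℕ
wt [] = 0
wt (true ∷ x) = suc (wt x)
wt (false ∷ x) = wt x

Code : ℕ → Set₁
Code n = Word n → Set

comb : ∀ {n k} → Vec (Word n) k → Word k → Word n
comb [] [] = 0w
comb (g ∷ G) (b ∷ m) = (b · g) ⊕ comb G m

-- C is an [n,k] code: a k-dimensional subspace of F_2^n, i.e. it has a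
-- basis of k linearly independent vectors spanning exactly C.
IsLinearCode : ∀ n k → Code n → Set
IsLinearCode n k C =
  Σ (Vec (Word n) k) λ G →
    (∀ m → comb G m ≡ 0w → m ≡ 0w)
    × (∀ c → C c → ∃ λ m → comb G m ≡ c)
    × (∀ m → C (comb G m))

Dual : ∀ {n} → Code n → Code n
Dual C y = ∀ c → C c → dot c y ≡ false

IsLCD : ∀ {n} → Code n → Set
IsLCD C = ∀ x → C x → Dual C x → x ≡ 0w

MinDist : ∀ {n} → Code n → ℕ → Set
MinDist C d =
  (∃ λ c → C c × c ≢ 0w × wt c ≡ d)
  × (∀ c → C c → c ≢ 0w → d ≤ wt c)

MinDistAtLeast : ∀ {n} → Code n → ℕ → Set
MinDistAtLeast D t = ∀ c → D c → c ≢ 0w → t ≤ wt c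

-- Write n − 2 = k + r and take the span D of a
-- systematic generator matrix [I | T]. Its Gram matrix is I + T Tᵀ, and D is LCD exactly
-- when this is nonsingular; d(D⊥) ≥ 2 means that no coordinate vanishes on all of D.
-- For r even let T have the all-ones row on top and zeros below: then T Tᵀ = 0, and the
-- all-ones word lies in D. For r odd and k ≥ 2 take the rows 1…1 and 10…0 on top: then
-- I + T Tᵀ is the hyperbolic plane [[0,1],[1,0]] plus an identity block. The remaining
-- case k = 1 with r odd, i.e. n even, cannot occur: a 1-dimensional code with d(C⊥) ≥ 2
-- is spanned by the all-ones word, which is self-orthogonal in even length. For k = 0,
-- C⊥ is everything, so d(C⊥) = 1.
module Submission where

open import Defs
open import Data.Nat using (ℕ; zero; suc; _+_; _≤_; _∸_; _^_; z≤n; s≤s)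
open import Data.Nat.Properties using (≤-trans; *-monoʳ-≤; m^n>0; suc-injective; n≮n; 0≢1+n)
open import Data.Bool using (Bool; true; false; _xor_; _∧_; _∨_; not)
open import Data.Bool.Properties using (∧-zeroʳ; ∧-identityʳ; xor-identityˡ; xor-identityʳ; xor-assoc)
open import Data.Vec using (Vec; []; _∷_; _++_; zipWith; replicate; map; head; tail)
open import Data.Vec.Properties
  using (++-injectiveˡ; zipWith-++; map-++; map-id; map-const; map-replicate;
         zipWith-replicate₁; zipWith-identityˡ; zipWith-identityʳ)
open import Data.Product using (Σ; ∃; _×_; _,_; proj₁; proj₂)
open import Data.Sum using (_⊎_; inj₁; inj₂; [_,_]′)
open import Data.Empty using (⊥; ⊥-elim)
open import Relation.Nullary using (¬_)
open import Relation.Binary.PropositionalEquality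

⊕-identityˡ : ∀ {n} (x : Word n) → 0w ⊕ x ≡ x
⊕-identityˡ = zipWith-identityˡ xor-identityˡ

⊕-identityʳ : ∀ {n} (x : Word n) → x ⊕ 0w ≡ x
⊕-identityʳ = zipWith-identityʳ xor-identityʳ

·-zeroˡ : ∀ {n} (x : Word n) → false · x ≡ 0w
·-zeroˡ x = map-const x false

·-identityˡ : ∀ {n} (x : Word n) → true · x ≡ x
·-identityˡ = map-id

·-replicate : ∀ n a b → a · replicate n b ≡ replicate n (a ∧ b)
·-replicate n a b = map-replicate (a ∧_) b n

·-zeroʳ : ∀ {n} b → b · 0w {n} ≡ 0w
·-zeroʳ {n} b = trans (·-replicate n b false) (cong (replicate n) (∧-zeroʳ b))

++-replicate : ∀ m n (a : Bool) → replicate m a ++ replicate n a ≡ replicate (m + n) a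
++-replicate zero    n a = refl
++-replicate (suc m) n a = cong (a ∷_) (++-replicate m n a)

wt≡0⇒≡0w : ∀ {n} (c : Word n) → wt c ≡ 0 → c ≡ 0w
wt≡0⇒≡0w []          _  = refl
wt≡0⇒≡0w (false ∷ c) eq = cong (false ∷_) (wt≡0⇒≡0w c eq)

wt-0w : ∀ n → wt (0w {n}) ≡ 0
wt-0w zero    = refl
wt-0w (suc n) = wt-0w n

odd : ℕ → Bool
odd zero    = false
odd (suc n) = not (odd n)

dot-zeroˡ : ∀ {n} (y : Word n) → dot 0w y ≡ false
dot-zeroˡ []      = refl
dot-zeroˡ (_ ∷ y) = dot-zeroˡ y

dot-zeroʳ : ∀ {n} (x : Word n) → dot x 0w ≡ false
dot-zeroʳ []          = refl
dot-zeroʳ (true ∷ x)  = dot-zeroʳ x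
dot-zeroʳ (false ∷ x) = dot-zeroʳ x

dot-·ˡ : ∀ {n} b (x y : Word n) → dot (b · x) y ≡ b ∧ dot x y
dot-·ˡ false x y = trans (cong (λ z → dot z y) (·-zeroˡ x)) (dot-zeroˡ y)
dot-·ˡ true  x y = cong (λ z → dot z y) (·-identityˡ x)

dot-++ : ∀ {m n} (x x′ : Word m) (y y′ : Word n) →
         dot (x ++ y) (x′ ++ y′) ≡ dot x x′ xor dot y y′
dot-++ []      []       y y′ = refl
dot-++ (a ∷ x) (b ∷ x′) y y′ =
  trans (cong ((a ∧ b) xor_) (dot-++ x x′ y y′)) (sym (xor-assoc (a ∧ b) (dot x x′) (dot y y′)))

dot-replicate : ∀ n a b → dot (replicate n a) (replicate n b) ≡ (a ∧ b) ∧ odd n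
dot-replicate zero    true  true  = refl
dot-replicate zero    true  false = refl
dot-replicate zero    false b     = refl
dot-replicate (suc n) true  true  = cong not (dot-replicate n true true)
dot-replicate (suc n) true  false = dot-replicate n true false
dot-replicate (suc n) false b     = dot-replicate n false b

dot-nondegenerate : ∀ {n} (u : Word n) → (∀ v → dot v u ≡ false) → u ≡ 0w
dot-nondegenerate []      _ = refl
dot-nondegenerate (a ∷ u) H = cong₂ _∷_ head≡false (dot-nondegenerate u (λ v → H (false ∷ v)))
  where
  head≡false : a ≡ false
  head≡false = trans (sym (xor-identityʳ a)) (trans (cong (a xor_) (sym (dot-zeroˡ u))) (H (true ∷ 0w)))

comb-zero : ∀ {m k} (G : Vec (Word m) k) → comb G 0w ≡ 0w
comb-zero []      = refl
comb-zero (g ∷ G) = trans (cong₂ _⊕_ (·-zeroˡ g) (comb-zero G)) (⊕-identityˡ 0w)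

comb-zeroRows : ∀ {m} k (u : Word k) → comb (replicate k (0w {m})) u ≡ 0w
comb-zeroRows zero    []      = refl
comb-zeroRows (suc k) (b ∷ u) = trans (cong₂ _⊕_ (·-zeroʳ b) (comb-zeroRows k u)) (⊕-identityˡ 0w)

comb-singleton : ∀ {n} (g : Word n) b → comb (g ∷ []) (b ∷ []) ≡ b · g
comb-singleton g b = ⊕-identityʳ (b · g)

comb-zipWith-++ : ∀ {m n k} (A : Vec (Word m) k) (B : Vec (Word n) k) u →
                  comb (zipWith _++_ A B) u ≡ comb A u ++ comb B u
comb-zipWith-++ {m} {n} []      []      []      = sym (++-replicate m n false)
comb-zipWith-++         (x ∷ A) (y ∷ B) (c ∷ u) =
  trans (cong₂ _⊕_ (map-++ (c ∧_) x y) (comb-zipWith-++ A B u))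
        (zipWith-++ _xor_ (c · x) (c · y) (comb A u) (comb B u))

comb-map-false∷ : ∀ {m k} (A : Vec (Word m) k) u → comb (map (false ∷_) A) u ≡ false ∷ comb A u
comb-map-false∷ []      []         = refl
comb-map-false∷ (x ∷ A) (true ∷ u)  = cong ((true · (false ∷ x)) ⊕_) (comb-map-false∷ A u)
comb-map-false∷ (x ∷ A) (false ∷ u) = cong ((false · (false ∷ x)) ⊕_) (comb-map-false∷ A u)

standardBasis : ∀ k → Vec (Word k) k
standardBasis zero    = []
standardBasis (suc k) = (true ∷ 0w) ∷ map (false ∷_) (standardBasis k)

comb-standardBasis : ∀ {k} (u : Word k) → comb (standardBasis k) u ≡ u
comb-standardBasis []          = refl
comb-standardBasis {suc k} (a ∷ u) =
  trans (cong ((a · (true ∷ 0w)) ⊕_) (comb-map-false∷ (standardBasis k) u))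
        (cong₂ _∷_ (trans (xor-identityʳ (a ∧ true)) (∧-identityʳ a)) tail-eq)
  where
  tail-eq : (a · 0w) ⊕ comb (standardBasis k) u ≡ u
  tail-eq = trans (cong (_⊕ comb (standardBasis k) u) (·-zeroʳ a))
                  (trans (⊕-identityˡ _) (comb-standardBasis u))

systematic : ∀ {k r} → Vec (Word r) k → Vec (Word (k + r)) k
systematic T = zipWith _++_ (standardBasis _) T

module _ {k r} (T : Vec (Word r) k) where

  comb-systematic : ∀ u → comb (systematic T) u ≡ u ++ comb T u
  comb-systematic u = trans (comb-zipWith-++ (standardBasis k) T u) (cong (_++ comb T u) (comb-standardBasis u))

  systematic-independent : ∀ u → comb (systematic T) u ≡ 0w → u ≡ 0w
  systematic-independent u eq =
    ++-injectiveˡ u 0w (trans (sym (comb-systematic u)) (trans eq (sym (++-replicate k r false))))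

  dot-comb-systematic : ∀ v u → dot (comb (systematic T) v) (comb (systematic T) u) ≡ dot v u xor dot (comb T v) (comb T u)
  dot-comb-systematic v u = trans (cong₂ dot (comb-systematic v) (comb-systematic u)) (dot-++ v u (comb T v) (comb T u))

weight-one-not-dual : ∀ {n} (C : Code n) → MinDistAtLeast (Dual C) 2 →
                      ∀ e → wt e ≡ 1 → ¬ Dual C e
weight-one-not-dual {n} C dual≥2 e wt≡1 e∈C⊥ = n≮n 1 (subst (2 ≤_) wt≡1 (dual≥2 e e∈C⊥ e≢0w))
  where
  e≢0w : e ≢ 0w
  e≢0w refl = 0≢1+n (trans (sym (wt-0w n)) wt≡1)

unit-covered : ∀ {n} (e x y : Word n) → wt e ≡ 1 → zipWith _∨_ x y ≡ replicate n true →
               dot x e ∨ dot y e ≡ true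
unit-covered (true ∷ e) (a ∷ x) (b ∷ y) wt≡1 cover
  rewrite wt≡0⇒≡0w e (suc-injective wt≡1) | dot-zeroʳ x | dot-zeroʳ y = at-head a b (cong head cover)
  where
  at-head : ∀ a b → a ∨ b ≡ true → ((a ∧ true) xor false) ∨ ((b ∧ true) xor false) ≡ true
  at-head true  _    _ = refl
  at-head false true _ = refl
unit-covered (false ∷ e) (a ∷ x) (b ∷ y) wt≡1 cover
  rewrite ∧-zeroʳ a | ∧-zeroʳ b = unit-covered e x y wt≡1 (cong tail cover)

covered⇒dual-distance≥2 : ∀ {n} (C : Code n) {x y} → C x → C y → zipWith _∨_ x y ≡ replicate n true →
                           MinDistAtLeast (Dual C) 2
covered⇒dual-distance≥2 C {x} {y} x∈C y∈C cover e e∈C⊥ e≢0w with wt e in wt≡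
... | zero        = ⊥-elim (e≢0w (wt≡0⇒≡0w e wt≡))
... | suc (suc _) = s≤s (s≤s z≤n)
... | suc zero
  with () ← subst₂ (λ p q → p ∨ q ≡ true) (e∈C⊥ x x∈C) (e∈C⊥ y y∈C) (unit-covered e x y wt≡ cover)

span : ∀ {m k} → Vec (Word m) k → Code m
span G c = ∃ λ u → comb G u ≡ c

LCDWithDualDistance≥2 : ℕ → ℕ → Set₁
LCDWithDualDistance≥2 m k = Σ (Code m) λ D → IsLinearCode m k D × IsLCD D × MinDistAtLeast (Dual D) 2

span-LCDWithDualDistance≥2 : ∀ {m k} (G : Vec (Word m) k) →
  (∀ u → comb G u ≡ 0w → u ≡ 0w) →
  (∀ u → (∀ v → dot (comb G v) (comb G u) ≡ false) → u ≡ 0w) →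
  ∀ x y → zipWith _∨_ (comb G x) (comb G y) ≡ replicate m true →
  LCDWithDualDistance≥2 m k
span-LCDWithDualDistance≥2 G independent nondegenerate x y cover =
  span G , (G , independent , (λ _ c∈G → c∈G) , (λ u → u , refl)) , isLCD ,
  covered⇒dual-distance≥2 (span G) (x , refl) (y , refl) cover
  where
  isLCD : IsLCD (span G)
  isLCD c (u , refl) c∈G⊥ =
    trans (cong (comb G) (nondegenerate u (λ v → c∈G⊥ (comb G v) (v , refl)))) (comb-zero G)

∨-allOnesˡ : ∀ {n} (y : Word n) → zipWith _∨_ (replicate n true) y ≡ replicate n true
∨-allOnesˡ y = trans (zipWith-replicate₁ _∨_ true y) (map-const y true)

dot-replicate-even : ∀ r → odd r ≡ false → ∀ a b → dot (replicate r a) (replicate r b) ≡ false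
dot-replicate-even r r-even a b =
  trans (dot-replicate r a b) (trans (cong ((a ∧ b) ∧_) r-even) (∧-zeroʳ (a ∧ b)))

evenTail : ∀ k r → Vec (Word r) (suc k)
evenTail k r = replicate r true ∷ replicate k 0w

comb-evenTail : ∀ k r a u → comb (evenTail k r) (a ∷ u) ≡ replicate r a
comb-evenTail k r a u = begin
  (a · replicate r true) ⊕ comb (replicate k 0w) u ≡⟨ cong₂ _⊕_ (·-replicate r a true) (comb-zeroRows k u) ⟩
  replicate r (a ∧ true) ⊕ 0w                      ≡⟨ ⊕-identityʳ _ ⟩
  replicate r (a ∧ true)                           ≡⟨ cong (replicate r) (∧-identityʳ a) ⟩
  replicate r a                                    ∎
  where open ≡-Reasoning

even-construction : ∀ k r → odd r ≡ false → LCDWithDualDistance≥2 (suc k + r) (suc k)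
even-construction k r r-even =
  span-LCDWithDualDistance≥2 G (systematic-independent T) nondegenerate allOnes allOnes cover
  where
  T = evenTail k r
  G = systematic T
  allOnes = replicate (suc k) true

  dot-comb-G : ∀ v u → dot (comb G v) (comb G u) ≡ dot v u
  dot-comb-G (b ∷ v) (a ∷ u) = begin
    dot (comb G (b ∷ v)) (comb G (a ∷ u))                         ≡⟨ dot-comb-systematic T (b ∷ v) (a ∷ u) ⟩
    dot (b ∷ v) (a ∷ u) xor dot (comb T (b ∷ v)) (comb T (a ∷ u)) ≡⟨ cong (dot (b ∷ v) (a ∷ u) xor_) tails-orthogonal ⟩
    dot (b ∷ v) (a ∷ u) xor false                                 ≡⟨ xor-identityʳ _ ⟩
    dot (b ∷ v) (a ∷ u)                                           ∎
    where
    open ≡-Reasoning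
    tails-orthogonal : dot (comb T (b ∷ v)) (comb T (a ∷ u)) ≡ false
    tails-orthogonal = trans (cong₂ dot (comb-evenTail k r b v) (comb-evenTail k r a u)) (dot-replicate-even r r-even b a)

  nondegenerate : ∀ u → (∀ v → dot (comb G v) (comb G u) ≡ false) → u ≡ 0w
  nondegenerate u H = dot-nondegenerate u (λ v → trans (sym (dot-comb-G v u)) (H v))

  comb-G-allOnes : comb G allOnes ≡ replicate (suc k + r) true
  comb-G-allOnes = trans (comb-systematic T allOnes)
                         (trans (cong (allOnes ++_) (comb-evenTail k r true _)) (++-replicate (suc k) r true))

  cover : zipWith _∨_ (comb G allOnes) (comb G allOnes) ≡ replicate (suc k + r) true
  cover = trans (cong (λ w → zipWith _∨_ w w) comb-G-allOnes) (∨-allOnesˡ (replicate (suc k + r) true))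

oddTail : ∀ k r → Vec (Word (suc r)) (suc (suc k))
oddTail k r = replicate (suc r) true ∷ (true ∷ 0w) ∷ replicate k 0w

comb-oddTail : ∀ k r a b u → comb (oddTail k r) (a ∷ b ∷ u) ≡ (a xor b) ∷ replicate r a
comb-oddTail k r a b u = begin
  (a · replicate (suc r) true) ⊕ ((b · (true ∷ 0w)) ⊕ comb (replicate k 0w) u)
    ≡⟨ cong ((a · replicate (suc r) true) ⊕_) (trans (cong ((b · (true ∷ 0w)) ⊕_) (comb-zeroRows k u)) (⊕-identityʳ _)) ⟩
  (a · replicate (suc r) true) ⊕ ((b ∧ true) ∷ (b · 0w))
    ≡⟨ cong₂ _⊕_ (·-replicate (suc r) a true) (cong ((b ∧ true) ∷_) (·-zeroʳ b)) ⟩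
  replicate (suc r) (a ∧ true) ⊕ ((b ∧ true) ∷ 0w)
    ≡⟨ cong₂ (λ p q → replicate (suc r) p ⊕ (q ∷ 0w)) (∧-identityʳ a) (∧-identityʳ b) ⟩
  (a xor b) ∷ (replicate r a ⊕ 0w)
    ≡⟨ cong ((a xor b) ∷_) (⊕-identityʳ (replicate r a)) ⟩
  (a xor b) ∷ replicate r a
    ∎
  where open ≡-Reasoning

-- The form (a′, b′) · (a, b) + (a′ + b′)(a + b) equals a′ b + b′ a: the hyperbolic plane.
hyperbolic-nondegenerate : ∀ a b →
  (∀ a′ b′ → ((a′ ∧ a) xor ((b′ ∧ b) xor false)) xor ((a′ xor b′) ∧ (a xor b)) ≡ false) →
  a ≡ false × b ≡ false
hyperbolic-nondegenerate false false _ = refl , refl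
hyperbolic-nondegenerate false true  H with () ← H true false
hyperbolic-nondegenerate true  false H with () ← H false true
hyperbolic-nondegenerate true  true  H with () ← H true false

odd-construction : ∀ k r → odd r ≡ false → LCDWithDualDistance≥2 (suc (suc k) + suc r) (suc (suc k))
odd-construction k r r-even = span-LCDWithDualDistance≥2 G (systematic-independent T) nondegenerate x y cover
  where
  T = oddTail k r
  G = systematic T
  x y : Word (suc (suc k))
  x = replicate (suc (suc k)) true
  y = true ∷ false ∷ 0w

  dot-comb-G : ∀ a′ b′ v a b u →
    dot (comb G (a′ ∷ b′ ∷ v)) (comb G (a ∷ b ∷ u)) ≡ dot (a′ ∷ b′ ∷ v) (a ∷ b ∷ u) xor ((a′ xor b′) ∧ (a xor b))
  dot-comb-G a′ b′ v a b u = begin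
    dot (comb G (a′ ∷ b′ ∷ v)) (comb G (a ∷ b ∷ u))
      ≡⟨ dot-comb-systematic T (a′ ∷ b′ ∷ v) (a ∷ b ∷ u) ⟩
    dot (a′ ∷ b′ ∷ v) (a ∷ b ∷ u) xor dot (comb T (a′ ∷ b′ ∷ v)) (comb T (a ∷ b ∷ u))
      ≡⟨ cong (dot (a′ ∷ b′ ∷ v) (a ∷ b ∷ u) xor_) tails ⟩
    dot (a′ ∷ b′ ∷ v) (a ∷ b ∷ u) xor ((a′ xor b′) ∧ (a xor b))
      ∎
    where
    open ≡-Reasoning
    tails : dot (comb T (a′ ∷ b′ ∷ v)) (comb T (a ∷ b ∷ u)) ≡ (a′ xor b′) ∧ (a xor b)
    tails = trans (cong₂ dot (comb-oddTail k r a′ b′ v) (comb-oddTail k r a b u))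
                  (trans (cong (((a′ xor b′) ∧ (a xor b)) xor_) (dot-replicate-even r r-even a′ a)) (xor-identityʳ _))

  nondegenerate : ∀ w → (∀ v → dot (comb G v) (comb G w) ≡ false) → w ≡ 0w
  nondegenerate (a ∷ b ∷ u) H = cong₂ _∷_ (proj₁ a,b≡false) (cong₂ _∷_ (proj₂ a,b≡false) u≡0w)
    where
    H′ : ∀ a′ b′ v → dot (a′ ∷ b′ ∷ v) (a ∷ b ∷ u) xor ((a′ xor b′) ∧ (a xor b)) ≡ false
    H′ a′ b′ v = trans (sym (dot-comb-G a′ b′ v a b u)) (H (a′ ∷ b′ ∷ v))
    u≡0w : u ≡ 0w
    u≡0w = dot-nondegenerate u (λ v → trans (sym (xor-identityʳ (dot v u))) (H′ false false v))
    a,b≡false : a ≡ false × b ≡ false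
    a,b≡false = hyperbolic-nondegenerate a b λ a′ b′ →
      subst (λ z → ((a′ ∧ a) xor ((b′ ∧ b) xor z)) xor ((a′ xor b′) ∧ (a xor b)) ≡ false) (dot-zeroˡ u) (H′ a′ b′ 0w)

  cover : zipWith _∨_ (comb G x) (comb G y) ≡ replicate (suc (suc k) + suc r) true
  cover = begin
    zipWith _∨_ (comb G x) (comb G y)
      ≡⟨ cong₂ (zipWith _∨_) (comb-systematic T x) (comb-systematic T y) ⟩
    zipWith _∨_ (x ++ comb T x) (y ++ comb T y)
      ≡⟨ zipWith-++ _∨_ x (comb T x) y (comb T y) ⟩
    zipWith _∨_ x y ++ zipWith _∨_ (comb T x) (comb T y)
      ≡⟨ cong₂ _++_ (∨-allOnesˡ y) (cong₂ (zipWith _∨_) (comb-oddTail k r true true _) (comb-oddTail k r true false 0w)) ⟩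
    x ++ (true ∷ zipWith _∨_ (replicate r true) (replicate r true))
      ≡⟨ cong (λ w → x ++ (true ∷ w)) (∨-allOnesˡ (replicate r true)) ⟩
    x ++ replicate (suc r) true
      ≡⟨ ++-replicate (suc (suc k)) (suc r) true ⟩
    replicate (suc (suc k) + suc r) true
      ∎
    where open ≡-Reasoning

construction : ∀ k r → (k ≡ 0 → odd r ≡ true → ⊥) → LCDWithDualDistance≥2 (suc k + r) (suc k)
construction k zero    _ = even-construction k zero refl
construction k (suc r) excluded with odd r in r-parity
construction k        (suc r) _        | true  = even-construction k (suc r) (cong not r-parity)
construction zero     (suc r) excluded | false = ⊥-elim (excluded refl refl)
construction (suc k′) (suc r) _        | false = odd-construction k′ r r-parity

zero-dimensional-dual-distance : ∀ {n} (C : Code (suc n)) → IsLinearCode (suc n) 0 C → ¬ MinDistAtLeast (Dual C) 2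
zero-dimensional-dual-distance {n} C ([] , _ , spanned , _) dual≥2 =
  weight-one-not-dual C dual≥2 unit (cong suc (wt-0w n)) unit∈C⊥
  where
  unit : Word (suc n)
  unit = true ∷ 0w
  unit∈C⊥ : Dual C unit
  unit∈C⊥ c c∈C with spanned c c∈C
  ... | [] , refl = dot-zeroˡ unit

allOnes-or-orthogonal-unit : ∀ {n} (g : Word n) → g ≡ replicate n true ⊎ ∃ λ e → wt e ≡ 1 × dot g e ≡ false
allOnes-or-orthogonal-unit []      = inj₁ refl
allOnes-or-orthogonal-unit {suc n} (false ∷ g) = inj₂ (true ∷ 0w , cong suc (wt-0w n) , dot-zeroʳ g)
allOnes-or-orthogonal-unit (true ∷ g) with allOnes-or-orthogonal-unit g
... | inj₁ g≡1 = inj₁ (cong (true ∷_) g≡1)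
... | inj₂ (e , wt≡1 , g·e≡0) = inj₂ (false ∷ e , wt≡1 , g·e≡0)

no-even-LCD-of-dimension-one : ∀ {n} (C : Code n) → IsLinearCode n 1 C → IsLCD C →
                               MinDistAtLeast (Dual C) 2 → odd n ≡ false → ⊥
no-even-LCD-of-dimension-one {n} C (g ∷ [] , independent , spanned , generated) isLCD dual≥2 n-even =
  [ not-allOnes , (λ (e , wt≡1 , g·e≡0) → weight-one-not-dual C dual≥2 e wt≡1 (g-orthogonal⇒dual g·e≡0)) ]′
    (allOnes-or-orthogonal-unit g)
  where
  g-orthogonal⇒dual : ∀ {y} → dot g y ≡ false → Dual C y
  g-orthogonal⇒dual {y} g·y≡0 c c∈C with spanned c c∈C
  ... | b ∷ [] , refl = trans (cong (λ z → dot z y) (comb-singleton g b))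
                              (trans (dot-·ˡ b g y) (trans (cong (b ∧_) g·y≡0) (∧-zeroʳ b)))
  g-as-comb : comb (g ∷ []) (true ∷ []) ≡ g
  g-as-comb = trans (comb-singleton g true) (·-identityˡ g)
  allOnes-self-dual : g ≡ replicate n true → Dual C g
  allOnes-self-dual refl = g-orthogonal⇒dual (trans (dot-replicate n true true) n-even)
  not-allOnes : g ≢ replicate n true
  not-allOnes g≡1
    with () ← independent (true ∷ [])
                (trans g-as-comb (isLCD g (subst C g-as-comb (generated (true ∷ []))) (allOnes-self-dual g≡1)))

2≤∸⇒≡2+ : ∀ n k → 2 ≤ n ∸ k → ∃ λ r → n ≡ 2 + (k + r)
2≤∸⇒≡2+ (suc (suc r)) zero    _         = r , refl
2≤∸⇒≡2+ (suc zero)    zero    (s≤s ())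
2≤∸⇒≡2+ (suc n)       (suc k) p         with 2≤∸⇒≡2+ n k p
... | r , refl = r , refl

2≤2^suc : ∀ k → 2 ≤ 2 ^ suc k
2≤2^suc k = *-monoʳ-≤ 2 (m^n>0 2 k)

lemma2p3 : (n k d : ℕ) (C : Code n) →
    IsLinearCode n k C → MinDist C d → IsLCD C →
    MinDistAtLeast (Dual C) 2 →
    2 ^ k ≤ n ∸ k →
    Σ (Code (n ∸ 2)) λ D →
      IsLinearCode (n ∸ 2) k D × IsLCD D × MinDistAtLeast (Dual D) 2
lemma2p3 zero    zero _ _ _ _ _ _ ()
lemma2p3 (suc n) zero _ C isLinear _ _ dual≥2 _ = ⊥-elim (zero-dimensional-dual-distance C isLinear dual≥2)
lemma2p3 n (suc k) _ C isLinear _ isLCD dual≥2 2^k≤n∸k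
  with 2≤∸⇒≡2+ n (suc k) (≤-trans (2≤2^suc k) 2^k≤n∸k)
... | r , refl = construction k r λ { refl r-odd →
  no-even-LCD-of-dimension-one C isLinear isLCD dual≥2 (cong (λ b → not (not (not b))) r-odd) }
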